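{- Let $G$ be an $R$-disjoint graph, $C$ an odd cycle of $G$, and $x\in V(C)\cup R_{\mathrm{even}}(C)$. Then $y\in R(C)$ for every edge $xy\in E(G)$.
   Context: All graphs are finite, simple and undirected. Let $M$ be a matching of $G$. An $M$-blossom is an odd cycle of length $2k+1$ containing exactly $k$ edges of $M$; its base is the vertex of the cycle not covered by these $k$ edges. An $M$-stem is an $M$-alternating path of even length (possibly zero) joining the base of the blossom to a vertex not saturated by $M$, and sharing only the base with the blossom. An $M$-flower is an $M$-blossom together with an $M$-stem. For an odd cycle $C$ of $G$, the reach set $R(C)$ is the union of $V(F)$ over all $M$-flowers $F$ of $G$ whose $M$-blossom is $C$, where $M$ ranges over all maximum matchings of $G$. A graph $G$ is $R$-disjoint if it has at least one odd cycle, $R(C)\neq\emptyset$ for every odd cycle $C$, and $R(C)\cap R(C')=\emptyset$ for every two distinct odd cycles $C,C'$ of $G$. For such $G$ and $C$, $R_{\mathrm{even}}(C)$ is the set of $x\in R(C)\setminus V(C)$ such that $d_F(x,c)$ is even for an $M$-flower $F$ of $G$ ($M$ a maximum matching) with $M$-blossom $C$ and base $c$ containing $x$, where $d_F$ is the distance in $F$ (this parity is independent of the choice of $M$ and $F$). -}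

module Defs where

open import Data.Nat using (ℕ; zero; suc; _+_; _*_; _∸_; _≤_)
open import Data.Fin using (Fin)
open import Data.Fin.Properties using () renaming (_≟_ to _≟ᶠ_)
open import Data.Product using (Σ; ∃; ∃-syntax; _×_; _,_; proj₁; proj₂; swap)
open import Data.Product.Properties using (≡-dec)
open import Data.Sum using (_⊎_; inj₁; inj₂)
open import Data.Empty using (⊥)
open import Data.Unit using (⊤)
open import Data.List using (List; []; _∷_; _++_; length; zip; filter; last)
open import Data.Maybe using (just)
open import Data.List.Membership.Propositional using (_∈_; _∉_)
open import Data.List.Relation.Unary.All using (All)
open import Data.List.Relation.Unary.Any using (Any)
open import Data.List.Relation.Unary.AllPairs using (AllPairs)
open import Data.List.Relation.Unary.Unique.Propositional using (Unique)
import Data.List.Membership.DecPropositional as DecMem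
open import Relation.Nullary using (¬_; Dec)
open import Relation.Nullary.Decidable using (_⊎-dec_)
open import Relation.Binary.PropositionalEquality using (_≡_; _≢_)
open import Function.Bundles using (_⇔_)

Even : ℕ → Set
Even m = ∃[ k ] m ≡ k + k

Odd : ℕ → Set
Odd m = ∃[ k ] m ≡ suc (k + k)

record Graph (n : ℕ) : Set₁ where
  field
    E       : Fin n → Fin n → Set
    E-sym   : ∀ {u v} → E u v → E v u
    E-irrefl : ∀ {u} → ¬ E u u

module _ {n : ℕ} (G : Graph n) where
  open Graph G

  Vertex : Set
  Vertex = Fin n

  Pair : Set
  Pair = Vertex × Vertex

  Disjoint : Pair → Pair → Set
  Disjoint (a , b) (c , d) = a ≢ c × a ≢ d × b ≢ c × b ≢ d

  IsMatching : List Pair → Set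
  IsMatching M = All (λ e → E (proj₁ e) (proj₂ e)) M × AllPairs Disjoint M

  IsMaximumMatching : List Pair → Set
  IsMaximumMatching M = IsMatching M × (∀ M' → IsMatching M' → length M' ≤ length M)

  InM : List Pair → Pair → Set
  InM M e = e ∈ M ⊎ swap e ∈ M

  inM? : (M : List Pair) → (e : Pair) → Dec (InM M e)
  inM? M e = (e ∈? M) ⊎-dec (swap e ∈? M)
    where open DecMem (≡-dec _≟ᶠ_ _≟ᶠ_)

  Covers : Vertex → Pair → Set
  Covers v e = v ≡ proj₁ e ⊎ v ≡ proj₂ e

  Saturated : List Pair → Vertex → Set
  Saturated M v = Any (Covers v) M

  -- cycle v0 … v(m-1) : edges v0v1, …, v(m-2)v(m-1), v(m-1)v0
  cycEdges : List Vertex → List Pair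
  cycEdges [] = []
  cycEdges (v ∷ vs) = zip (v ∷ vs) (vs ++ v ∷ [])

  IsCycle : List Vertex → Set
  IsCycle C = 3 ≤ length C × Unique C × All (λ e → E (proj₁ e) (proj₂ e)) (cycEdges C)

  IsOddCycle : List Vertex → Set
  IsOddCycle C = IsCycle C × Odd (length C)

  -- two cycle representations denote the same cycle (subgraph) iff same edge set
  SameCycle : List Vertex → List Vertex → Set
  SameCycle C C' = ∀ u v → InM (cycEdges C) (u , v) ⇔ InM (cycEdges C') (u , v)

  IsBlossom : List Pair → List Vertex → Vertex → Set
  IsBlossom M C c =
    IsOddCycle C ×
    (∃[ k ] (length C ≡ suc (k + k) ×
             length (filter (inM? M) (cycEdges C)) ≡ k)) ×
    c ∈ C ×
    (∀ e → e ∈ cycEdges C → InM M e → ¬ Covers c e)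

  pathEdges : List Vertex → List Pair
  pathEdges (p ∷ q ∷ rest) = (p , q) ∷ pathEdges (q ∷ rest)
  pathEdges _ = []

  Alternating : List Pair → List Vertex → Set
  Alternating M (u ∷ v ∷ w ∷ rest) =
    ((InM M (u , v) × ¬ InM M (v , w)) ⊎ (¬ InM M (u , v) × InM M (v , w))) ×
    Alternating M (v ∷ w ∷ rest)
  Alternating M _ = ⊤

  IsStem : List Pair → List Vertex → Vertex → List Vertex → Set
  IsStem M C c [] = ⊥
  IsStem M C c (p ∷ rest) =
    p ≡ c ×
    Unique (p ∷ rest) ×
    All (λ e → E (proj₁ e) (proj₂ e)) (pathEdges (p ∷ rest)) ×
    Alternating M (p ∷ rest) ×
    Even (length rest) ×
    (∃[ w ] (last (p ∷ rest) ≡ just w × ¬ Saturated M w)) ×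
    (∀ v → v ∈ rest → v ∉ C)

  IsFlower : List Pair → List Vertex → Vertex → List Vertex → Set
  IsFlower M C c P = IsBlossom M C c × IsStem M C c P

  FEdge : List Vertex → List Vertex → Vertex → Vertex → Set
  FEdge C P u v = InM (cycEdges C) (u , v) ⊎ InM (pathEdges P) (u , v)

  InFlower : List Vertex → List Vertex → Vertex → Set
  InFlower C P x = x ∈ C ⊎ x ∈ P

  data FWalk (C P : List Vertex) : Vertex → Vertex → ℕ → Set where
    here : ∀ {u} → FWalk C P u u zero
    step : ∀ {u v w k} → FEdge C P u v → FWalk C P v w k → FWalk C P u w (suc k)

  FDist : List Vertex → List Vertex → Vertex → Vertex → ℕ → Set
  FDist C P x y d = FWalk C P x y d × (∀ k → FWalk C P x y k → d ≤ k)

  R : List Vertex → Vertex → Set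
  R C x = ∃[ M ] (IsMaximumMatching M × ∃[ c ] ∃[ P ] (IsFlower M C c P × InFlower C P x))

  RDisjoint : Set
  RDisjoint =
    (∃[ C ] IsOddCycle C) ×
    (∀ C → IsOddCycle C → ∃[ x ] R C x) ×
    (∀ C C' → IsOddCycle C → IsOddCycle C' → ¬ SameCycle C C' → ∀ x → R C x → R C' x → ⊥)

  REven : List Vertex → Vertex → Set
  REven C x =
    R C x × x ∉ C ×
    ∃[ M ] (IsMaximumMatching M × ∃[ c ] ∃[ P ]
      (IsFlower M C c P × InFlower C P x × ∃[ d ] (FDist C P x c d × Even d)))

-- Let M be a maximum matching and F an M-flower on C whose stem ends at the
-- free vertex w. Every neighbour y of w lies in R(C): either y is in F, or y is
-- matched (otherwise wy would augment M) to some z, and z is outside F because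
-- M-partners of flower vertices stay in F; then M − yz + wy is again maximum and
-- the stem extended by y z is a stem ending at the free vertex z.
-- It therefore suffices to make x the free end of a stem. If x lies on the stem
-- at even distance, hence at an even position, from the base, exchanging the
-- matched pairs of the stem beyond x cuts the stem back to end at x. If x lies
-- on C, cut the stem back to the base alone, which is then free; exchanging the
-- blossom edge b d₁ for the M-edge d₁ d₂ moves the free base two steps along C,
-- and since C is odd every vertex of C is reached this way.

module Submission where

open import Defs
open import Data.Nat using (ℕ; zero; suc; _+_; _≤_; z≤n; s≤s)
open import Data.Nat.Properties using (≤-trans; ≤-antisym; <⇒≤; ≤-reflexive; <-irrefl; 1+n≰n; m≤n⇒m≤1+n; +-suc; +-comm; +-identityʳ; suc-injective)
open import Data.Fin using () renaming (_≟_ to _≟ᶠ_)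
open import Data.Product using (∃-syntax; _×_; _,_; proj₁; proj₂)
open import Data.Sum using (_⊎_; inj₁; inj₂; [_,_]′)
open import Data.Empty using (⊥-elim)
open import Data.Unit using (tt)
open import Data.Maybe using (just)
open import Data.List using (List; []; _∷_; _++_; length; zip; filter; last)
open import Data.List.Properties using (length-++; ++-assoc; ++-identityʳ; filter-accept; filter-reject; filter-all; filter-++)
open import Data.List.Membership.Propositional using (_∈_; _∉_; find; lose)
open import Data.List.Membership.Propositional.Properties using (∈-filter⁺; ∈-filter⁻; ∈-++⁺ˡ; ∈-++⁺ʳ; ∈-++⁻; ∈-∃++)
open import Data.List.Relation.Unary.All using (All; []; _∷_)
import Data.List.Relation.Unary.All as All
import Data.List.Relation.Unary.All.Properties as All
open import Data.List.Relation.Unary.Any using (here; there; any?)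
open import Data.List.Relation.Unary.AllPairs using (AllPairs; []; _∷_)
import Data.List.Relation.Unary.AllPairs as AllPairs
import Data.List.Relation.Unary.AllPairs.Properties as AllPairs
open import Data.List.Relation.Unary.Unique.Propositional using (Unique)
open import Data.List.Relation.Unary.Unique.Propositional.Properties using (Unique[x∷xs]⇒x∉xs)
import Data.List.Relation.Unary.Unique.Propositional.Properties as Unique
open import Data.List.Relation.Binary.Permutation.Propositional using (_↭_; ↭-sym; ↭-reflexive; ↭⇒↭ₛ; module PermutationReasoning)
open import Data.List.Relation.Binary.Permutation.Propositional.Properties using (∈-resp-↭; All-resp-↭; ↭-length; ++-comm; filter-↭)
import Data.List.Relation.Binary.Permutation.Setoid.Properties as Permutationₛ
open import Relation.Nullary using (¬_; Dec; yes; no)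
open import Relation.Nullary.Decidable using (¬?; _⊎-dec_)
open import Relation.Binary.PropositionalEquality using (_≡_; _≢_; refl; sym; trans; cong; subst; setoid; module ≡-Reasoning)
open import Function using (_∘_)
open import Function.Bundles using (_⇔_; mk⇔; Equivalence)

module _ {a r} {A : Set a} {R : A → A → Set r} where

  AllPairs-lookup : ∀ {xs x y} → AllPairs R xs → x ∈ xs → y ∈ xs → x ≡ y ⊎ R x y ⊎ R y x
  AllPairs-lookup (_  ∷ _)   (here refl) (here refl) = inj₁ refl
  AllPairs-lookup (Rx ∷ _)   (here refl) (there y∈) = inj₂ (inj₁ (All.lookup Rx y∈))
  AllPairs-lookup (Rx ∷ _)   (there x∈)  (here refl) = inj₂ (inj₂ (All.lookup Rx x∈))
  AllPairs-lookup (_  ∷ Rxs) (there x∈)  (there y∈) = AllPairs-lookup Rxs x∈ y∈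

  AllPairs-++⁻ˡ : ∀ xs {ys} → AllPairs R (xs ++ ys) → AllPairs R xs
  AllPairs-++⁻ˡ []       _          = []
  AllPairs-++⁻ˡ (x ∷ xs) (Rx ∷ Rxs) = All.++⁻ˡ xs Rx ∷ AllPairs-++⁻ˡ xs Rxs

  AllPairs-++⁻-across : ∀ xs {ys x y} → AllPairs R (xs ++ ys) → x ∈ xs → y ∈ ys → R x y
  AllPairs-++⁻-across (_ ∷ xs) (Rx ∷ _)  (here refl) y∈ = All.lookup Rx (∈-++⁺ʳ xs y∈)
  AllPairs-++⁻-across (_ ∷ xs) (_ ∷ Rxs) (there x∈)  y∈ = AllPairs-++⁻-across xs Rxs x∈ y∈

module _ {a} {A : Set a} where

  lastOf : A → List A → A
  lastOf x []       = x
  lastOf _ (y ∷ ys) = lastOf y ys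

  last≡lastOf : ∀ x xs → last (x ∷ xs) ≡ just (lastOf x xs)
  last≡lastOf x []       = refl
  last≡lastOf x (y ∷ ys) = last≡lastOf y ys

  lastOf-++ : ∀ x xs {y ys} → lastOf x (xs ++ y ∷ ys) ≡ lastOf y ys
  lastOf-++ x []       = refl
  lastOf-++ x (z ∷ xs) = lastOf-++ z xs

  length-++-pair : ∀ (xs : List A) {y z : A} → length (xs ++ y ∷ z ∷ []) ≡ suc (suc (length xs))
  length-++-pair xs = trans (length-++ xs) (+-comm (length xs) 2)

  lastOf-∈ : ∀ x xs → lastOf x xs ∈ x ∷ xs
  lastOf-∈ x []       = here refl
  lastOf-∈ x (y ∷ ys) = there (lastOf-∈ y ys)

  infix 4 _[_]=_
  data _[_]=_ : List A → ℕ → A → Set a where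
    here  : ∀ {x xs} → x ∷ xs [ 0 ]= x
    there : ∀ {x y xs i} → xs [ i ]= x → y ∷ xs [ suc i ]= x

  []=⇒∈ : ∀ {xs i x} → xs [ i ]= x → x ∈ xs
  []=⇒∈ here      = here refl
  []=⇒∈ (there p) = there ([]=⇒∈ p)

  ∈⇒[]= : ∀ {xs x} → x ∈ xs → ∃[ i ] xs [ i ]= x
  ∈⇒[]= (here refl) = 0 , here
  ∈⇒[]= (there x∈) with ∈⇒[]= x∈
  ... | i , p = suc i , there p

  []=-injective : ∀ {xs i j x} → Unique xs → xs [ i ]= x → xs [ j ]= x → i ≡ j
  []=-injective _            here      here      = refl
  []=-injective (x∉ ∷ _)     here      (there q) = ⊥-elim (All.lookup x∉ ([]=⇒∈ q) refl)
  []=-injective (x∉ ∷ _)     (there p) here      = ⊥-elim (All.lookup x∉ ([]=⇒∈ p) refl)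
  []=-injective (_ ∷ unique) (there p) (there q) = cong suc ([]=-injective unique p q)

  []=-++ˡ : ∀ {xs ys i x} → xs [ i ]= x → xs ++ ys [ i ]= x
  []=-++ˡ here      = here
  []=-++ˡ (there p) = there ([]=-++ˡ p)

  []=-++ : ∀ xs {x ys} → xs ++ x ∷ ys [ length xs ]= x
  []=-++ []       = here
  []=-++ (_ ∷ xs) = there ([]=-++ xs)

  []=-split : ∀ {x xs i y} → x ∷ xs [ i ]= y →
              ∃[ ys ] ∃[ zs ] xs ≡ ys ++ zs × length ys ≡ i × lastOf x ys ≡ y
  []=-split here = [] , _ , refl , refl , refl
  []=-split {xs = x′ ∷ xs} (there p) with []=-split p
  ... | ys , zs , refl , refl , refl = x′ ∷ ys , zs , refl , refl , refl

Even-pred : ∀ {m} → Even (suc (suc m)) → Even m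
Even-pred (suc k , eq) = k , suc-injective (trans (suc-injective eq) (+-suc k k))

double-suc-injective : ∀ m n → suc m + suc m ≡ suc (suc n) → m + m ≡ n
double-suc-injective m n eq = suc-injective (suc-injective (trans (sym (cong suc (+-suc m m))) eq))

Even-suc-suc : ∀ {m} → Even m → Even (suc (suc m))
Even-suc-suc (k , refl) = suc k , cong suc (sym (+-suc k k))

Even-double+⁻ : ∀ h {m} → Even ((h + h) + m) → Even m
Even-double+⁻ zero    even = even
Even-double+⁻ (suc h) even rewrite +-suc h h = Even-double+⁻ h (Even-pred even)

Odd-pred : ∀ {m} → Odd (suc (suc m)) → Odd m
Odd-pred (suc k , eq) = k , trans (suc-injective (suc-injective eq)) (+-suc k k)

parity : ∀ m → Even m ⊎ Odd m
parity zero    = inj₁ (0 , refl)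
parity (suc m) with parity m
... | inj₁ (k , eq) = inj₂ (k , cong suc eq)
... | inj₂ (k , eq) = inj₁ (suc k , trans (cong suc eq) (cong suc (sym (+-suc k k))))

¬Even-1 : ¬ Even 1
¬Even-1 (suc k , eq) with () ← trans (suc-injective eq) (+-suc k k)

module _ {n : ℕ} (G : Graph n) where
  open Graph G
  open import Data.List.Membership.DecPropositional (_≟ᶠ_ {n}) using (_∈?_)

  saturated? : ∀ M v → Dec (Saturated G M v)
  saturated? M v = any? (λ f → (v ≟ᶠ proj₁ f) ⊎-dec (v ≟ᶠ proj₂ f)) M

  Covers-disjoint : ∀ {v f g} → Covers G v f → Covers G v g → ¬ Disjoint G f g
  Covers-disjoint (inj₁ refl) (inj₁ refl) (a≢c , _) = a≢c refl
  Covers-disjoint (inj₁ refl) (inj₂ refl) (_ , a≢d , _) = a≢d refl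
  Covers-disjoint (inj₂ refl) (inj₁ refl) (_ , _ , b≢c , _) = b≢c refl
  Covers-disjoint (inj₂ refl) (inj₂ refl) (_ , _ , _ , b≢d) = b≢d refl

  covering-edge-unique : ∀ {M f g v} → AllPairs (Disjoint G) M → f ∈ M → g ∈ M →
                         Covers G v f → Covers G v g → f ≡ g
  covering-edge-unique M-disj f∈ g∈ vf vg with AllPairs-lookup M-disj f∈ g∈
  ... | inj₁ f≡g        = f≡g
  ... | inj₂ (inj₁ f#g) = ⊥-elim (Covers-disjoint vf vg f#g)
  ... | inj₂ (inj₂ g#f) = ⊥-elim (Covers-disjoint vg vf g#f)

  partner-unique : ∀ {M v a b} → IsMatching G M → InM G M (v , a) → InM G M (v , b) → a ≡ b
  partner-unique (_ , M-disj) va vb with va | vb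
  ... | inj₁ va∈ | inj₁ vb∈ with refl ← covering-edge-unique M-disj va∈ vb∈ (inj₁ refl) (inj₁ refl) = refl
  ... | inj₁ va∈ | inj₂ bv∈ with refl ← covering-edge-unique M-disj va∈ bv∈ (inj₁ refl) (inj₂ refl) = refl
  ... | inj₂ av∈ | inj₁ vb∈ with refl ← covering-edge-unique M-disj av∈ vb∈ (inj₂ refl) (inj₁ refl) = refl
  ... | inj₂ av∈ | inj₂ bv∈ with refl ← covering-edge-unique M-disj av∈ bv∈ (inj₂ refl) (inj₂ refl) = refl

  InM-sym : ∀ {M u v} → InM G M (u , v) → InM G M (v , u)
  InM-sym (inj₁ uv∈) = inj₂ uv∈
  InM-sym (inj₂ vu∈) = inj₁ vu∈

  InM⇒E : ∀ {M u v} → IsMatching G M → InM G M (u , v) → E u v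
  InM⇒E (M-edges , _) (inj₁ uv∈) = All.lookup M-edges uv∈
  InM⇒E (M-edges , _) (inj₂ vu∈) = E-sym (All.lookup M-edges vu∈)

  InM⇒Saturatedˡ : ∀ {M u v} → InM G M (u , v) → Saturated G M u
  InM⇒Saturatedˡ (inj₁ uv∈) = lose uv∈ (inj₁ refl)
  InM⇒Saturatedˡ (inj₂ vu∈) = lose vu∈ (inj₂ refl)

  InM⇒Saturatedʳ : ∀ {M u v} → InM G M (u , v) → Saturated G M v
  InM⇒Saturatedʳ = InM⇒Saturatedˡ ∘ InM-sym

  Saturated⇒InM : ∀ {M v} → Saturated G M v → ∃[ w ] InM G M (v , w)
  Saturated⇒InM sat with find sat
  ... | (_ , w) , vw∈ , inj₁ refl = w , inj₁ vw∈
  ... | (w , _) , wv∈ , inj₂ refl = w , inj₂ wv∈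

  maximum⇒¬free-edge : ∀ {M u v} → IsMaximumMatching G M →
                        ¬ Saturated G M u → ¬ Saturated G M v → ¬ E u v
  maximum⇒¬free-edge {M} {u} {v} ((M-edges , M-disj) , M-max) u-free v-free uv =
    <-irrefl refl (M-max ((u , v) ∷ M) ((uv ∷ M-edges) , (All.tabulate disjoint ∷ M-disj)))
    where
    disjoint : ∀ {f} → f ∈ M → Disjoint G (u , v) f
    disjoint f∈ = (u-free ∘ lose f∈ ∘ inj₁) , (u-free ∘ lose f∈ ∘ inj₂) ,
                  (v-free ∘ lose f∈ ∘ inj₁) , (v-free ∘ lose f∈ ∘ inj₂)

  -- Exchanging an edge of a matching

  exchange : List (Pair G) → Vertex G → Vertex G → Vertex G → List (Pair G)
  exchange M u v t = (u , v) ∷ filter (λ f → ¬? (inM? G ((v , t) ∷ []) f)) M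

  module _ {M : List (Pair G)} {u v t : Vertex G} where

    private
      M′ = exchange M u v t
      keep = λ f → ¬? (inM? G ((v , t) ∷ []) f)

      ¬vt : ∀ {a b} → v ≢ a → v ≢ b → ¬ InM G ((v , t) ∷ []) (a , b)
      ¬vt v≢a v≢b (inj₁ (here refl)) = v≢a refl
      ¬vt v≢a v≢b (inj₂ (here refl)) = v≢b refl

      at-v : ∀ {g} → InM G ((v , t) ∷ []) g → Covers G v g
      at-v (inj₁ (here refl)) = inj₁ refl
      at-v (inj₂ (here refl)) = inj₂ refl

      kept-length : ∀ {K} → AllPairs (Disjoint G) K → InM G K (v , t) →
                    suc (length (filter keep K)) ≡ length K
      kept-length {[]} [] (inj₁ ())
      kept-length {[]} [] (inj₂ ())
      kept-length {f ∷ K} (f#K ∷ K-disj) vt∈ with inM? G ((v , t) ∷ []) f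
      ... | yes f≈vt rewrite filter-reject keep {f} {K} (λ f≉vt → f≉vt f≈vt)
                           | filter-all keep {K} (All.map (λ f#g g≈vt → Covers-disjoint (at-v f≈vt) (at-v g≈vt) f#g) f#K) = refl
      ... | no f≉vt rewrite filter-accept keep {f} {K} f≉vt = cong suc (kept-length K-disj (in-tail vt∈))
        where
        in-tail : InM G (f ∷ K) (v , t) → InM G K (v , t)
        in-tail (inj₁ (here refl))  = ⊥-elim (f≉vt (inj₁ (here refl)))
        in-tail (inj₁ (there vt∈K)) = inj₁ vt∈K
        in-tail (inj₂ (here refl))  = ⊥-elim (f≉vt (inj₂ (here refl)))
        in-tail (inj₂ (there tv∈K)) = inj₂ tv∈K

    exchange-InM-new : InM G M′ (u , v)
    exchange-InM-new = inj₁ (here refl)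

    exchange-InM⁻ : ∀ {a b} → InM G M′ (a , b) → v ≡ a ⊎ v ≡ b ⊎ InM G M (a , b)
    exchange-InM⁻ (inj₁ (here refl))  = inj₂ (inj₁ refl)
    exchange-InM⁻ (inj₁ (there ab∈))  = inj₂ (inj₂ (inj₁ (proj₁ (∈-filter⁻ keep ab∈))))
    exchange-InM⁻ (inj₂ (here refl))  = inj₁ refl
    exchange-InM⁻ (inj₂ (there ba∈))  = inj₂ (inj₂ (inj₂ (proj₁ (∈-filter⁻ keep ba∈))))

    exchange-agree : ∀ {a b} → v ≢ a → v ≢ b → InM G M (a , b) ⇔ InM G M′ (a , b)
    exchange-agree v≢a v≢b = mk⇔ into-M′ back-to-M
      where
      into-M′ : InM G M _ → InM G M′ _
      into-M′ (inj₁ ab∈) = inj₁ (there (∈-filter⁺ keep ab∈ (¬vt v≢a v≢b)))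
      into-M′ (inj₂ ba∈) = inj₂ (there (∈-filter⁺ keep ba∈ (¬vt v≢b v≢a)))
      back-to-M : InM G M′ _ → InM G M _
      back-to-M ab∈ with exchange-InM⁻ ab∈
      ... | inj₁ v≡a         = ⊥-elim (v≢a v≡a)
      ... | inj₂ (inj₁ v≡b)  = ⊥-elim (v≢b v≡b)
      ... | inj₂ (inj₂ ab∈M) = ab∈M

    exchange-isMaximum : IsMaximumMatching G M → ¬ Saturated G M u → E u v → InM G M (v , t) →
                         IsMaximumMatching G M′
    exchange-isMaximum (M-matching@(M-edges , M-disj) , M-max) u-free uv vt∈ =
      ((uv ∷ All.filter⁺ keep M-edges) , (All.tabulate disjoint ∷ AllPairs.filter⁺ keep M-disj)) ,
      λ K K-matching → ≤-trans (M-max K K-matching) (≤-reflexive (sym (kept-length M-disj vt∈)))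
      where
      disjoint : ∀ {f} → f ∈ filter keep M → Disjoint G (u , v) f
      disjoint {f₁ , f₂} f∈ with ∈-filter⁻ keep f∈
      ... | f∈M , f≉vt =
        (u-free ∘ lose f∈M ∘ inj₁) , (u-free ∘ lose f∈M ∘ inj₂) ,
        (λ { refl → f≉vt (inj₁ (here (cong (v ,_) (partner-unique M-matching (inj₁ f∈M) vt∈)))) }) ,
        (λ { refl → f≉vt (inj₂ (here (cong (v ,_) (partner-unique M-matching (inj₂ f∈M) vt∈)))) })

    exchange-unsaturated : IsMatching G M → ¬ Saturated G M u → InM G M (v , t) → ¬ Saturated G M′ t
    exchange-unsaturated M-matching u-free vt∈ (here (inj₁ refl)) = u-free (InM⇒Saturatedʳ vt∈)
    exchange-unsaturated M-matching u-free vt∈ (here (inj₂ refl)) = E-irrefl (InM⇒E M-matching vt∈)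
    exchange-unsaturated M-matching u-free vt∈ (there t-sat) with find t-sat
    ... | (f₁ , f₂) , f∈ , t-covers with ∈-filter⁻ keep f∈ | t-covers
    ... | f∈M , f≉vt | inj₁ refl =
      f≉vt (inj₂ (here (cong (_, t) (partner-unique M-matching (inj₁ f∈M) (InM-sym vt∈)))))
    ... | f∈M , f≉vt | inj₂ refl =
      f≉vt (inj₁ (here (cong (_, t) (partner-unique M-matching (inj₂ f∈M) (InM-sym vt∈)))))

  Agree : List (Pair G) → List (Pair G) → List (Pair G) → Set
  Agree M M′ es = ∀ {a b} → (a , b) ∈ es → InM G M (a , b) ⇔ InM G M′ (a , b)

  Within : List (Vertex G) → List (Pair G) → Set
  Within L es = ∀ {a b} → (a , b) ∈ es → a ∈ L × b ∈ L

  exchange-Agree : ∀ {M u v t L es} → v ∉ L → Within L es → Agree M (exchange M u v t) es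
  exchange-Agree v∉L es⊆L ab∈ with es⊆L ab∈
  ... | a∈L , b∈L = exchange-agree (λ { refl → v∉L a∈L }) (λ { refl → v∉L b∈L })

  countIn : List (Pair G) → List (Pair G) → ℕ
  countIn M es = length (filter (inM? G M) es)

  countIn-∷-∈ : ∀ {M e} es → InM G M e → countIn M (e ∷ es) ≡ suc (countIn M es)
  countIn-∷-∈ {M} es e∈ = cong length (filter-accept (inM? G M) e∈)

  countIn-∷-∉ : ∀ {M e} es → ¬ InM G M e → countIn M (e ∷ es) ≡ countIn M es
  countIn-∷-∉ {M} es e∉ = cong length (filter-reject (inM? G M) e∉)

  countIn-++ : ∀ M xs ys → countIn M (xs ++ ys) ≡ countIn M xs + countIn M ys
  countIn-++ M xs ys = trans (cong length (filter-++ (inM? G M) xs ys)) (length-++ (filter (inM? G M) xs))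

  countIn-↭ : ∀ M {es es′} → es ↭ es′ → countIn M es ≡ countIn M es′
  countIn-↭ M es↭es′ = ↭-length (filter-↭ (inM? G M) es↭es′)

  countIn-Agree : ∀ {M M′} es → Agree M M′ es → countIn M es ≡ countIn M′ es
  countIn-Agree []             agree = refl
  countIn-Agree {M} {M′} (e ∷ es) agree with inM? G M e
  ... | yes e∈ = trans (countIn-∷-∈ es e∈)
                   (trans (cong suc (countIn-Agree es (agree ∘ there)))
                     (sym (countIn-∷-∈ es (Equivalence.to (agree (here refl)) e∈))))
  ... | no e∉  = trans (countIn-∷-∉ es e∉)
                   (trans (countIn-Agree es (agree ∘ there))
                     (sym (countIn-∷-∉ es (e∉ ∘ Equivalence.from (agree (here refl))))))

  IsBlossom-Agree : ∀ {M M′ C b} → Agree M M′ (cycEdges G C) → IsBlossom G M C b → IsBlossom G M′ C b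
  IsBlossom-Agree {C = C} agree (odd-cycle , (k , len , count) , b∈C , b-uncovered) =
    odd-cycle , (k , len , trans (sym (countIn-Agree (cycEdges G C) agree)) count) , b∈C ,
    λ { (_ , _) e∈ e∈M′ → b-uncovered _ e∈ (Equivalence.from (agree e∈) e∈M′) }

  -- Paths, cycles and rotations

  pathEdges-within : ∀ L → Within L (pathEdges G L)
  pathEdges-within (a ∷ b ∷ L) (here refl) = here refl , there (here refl)
  pathEdges-within (a ∷ b ∷ L) (there e∈) with pathEdges-within (b ∷ L) e∈
  ... | x∈ , y∈ = there x∈ , there y∈

  cycEdges-as-pathEdges : ∀ x xs → cycEdges G (x ∷ xs) ≡ pathEdges G (x ∷ xs ++ x ∷ [])
  cycEdges-as-pathEdges x xs = zip-as-path x xs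
    where
    zip-as-path : ∀ a as → zip (a ∷ as) (as ++ x ∷ []) ≡ pathEdges G (a ∷ as ++ x ∷ [])
    zip-as-path a []       = refl
    zip-as-path a (b ∷ bs) = cong ((a , b) ∷_) (zip-as-path b bs)

  cycEdges-within : ∀ C → Within C (cycEdges G C)
  cycEdges-within (x ∷ xs) e∈ with pathEdges-within (x ∷ xs ++ x ∷ []) (subst (_ ∈_) (cycEdges-as-pathEdges x xs) e∈)
  ... | a∈ , b∈ = closing a∈ , closing b∈
    where
    closing : ∀ {v} → v ∈ x ∷ xs ++ x ∷ [] → v ∈ x ∷ xs
    closing (here refl) = here refl
    closing (there v∈) with ∈-++⁻ xs v∈
    ... | inj₁ v∈xs        = there v∈xs
    ... | inj₂ (here refl) = here refl

  pathEdges-++ : ∀ xs y ys → pathEdges G (xs ++ y ∷ ys) ≡ pathEdges G (xs ++ y ∷ []) ++ pathEdges G (y ∷ ys)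
  pathEdges-++ []           y ys = refl
  pathEdges-++ (x ∷ [])     y ys = refl
  pathEdges-++ (x ∷ x′ ∷ xs) y ys = cong ((x , x′) ∷_) (pathEdges-++ (x′ ∷ xs) y ys)

  pathEdges-extend : ∀ x xs y z →
                     pathEdges G (x ∷ xs ++ y ∷ z ∷ []) ≡ pathEdges G (x ∷ xs) ++ (lastOf x xs , y) ∷ (y , z) ∷ []
  pathEdges-extend x []       y z = refl
  pathEdges-extend x (w ∷ xs) y z = cong ((x , w) ∷_) (pathEdges-extend w xs y z)

  pathEdges-snoc : ∀ x xs y → pathEdges G (x ∷ xs ++ y ∷ []) ≡ pathEdges G (x ∷ xs) ++ (lastOf x xs , y) ∷ []
  pathEdges-snoc x []       y = refl
  pathEdges-snoc x (z ∷ xs) y = cong ((x , z) ∷_) (pathEdges-snoc z xs y)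

  cycEdges-rotate : ∀ xs ys → cycEdges G (xs ++ ys) ↭ cycEdges G (ys ++ xs)
  cycEdges-rotate []       ys       = ↭-reflexive (cong (cycEdges G) (sym (++-identityʳ ys)))
  cycEdges-rotate (x ∷ xs) []       = ↭-reflexive (cong (cycEdges G) (++-identityʳ (x ∷ xs)))
  cycEdges-rotate (x ∷ xs) (y ∷ ys) = begin
    cycEdges G (x ∷ xs ++ y ∷ ys)                                    ≡⟨ cycEdges-as-pathEdges x (xs ++ y ∷ ys) ⟩
    pathEdges G (x ∷ (xs ++ y ∷ ys) ++ x ∷ [])                      ≡⟨ cong (λ l → pathEdges G (x ∷ l)) (++-assoc xs (y ∷ ys) (x ∷ [])) ⟩
    pathEdges G ((x ∷ xs) ++ y ∷ ys ++ x ∷ [])                      ≡⟨ pathEdges-++ (x ∷ xs) y (ys ++ x ∷ []) ⟩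
    pathEdges G (x ∷ xs ++ y ∷ []) ++ pathEdges G (y ∷ ys ++ x ∷ []) ↭⟨ ++-comm (pathEdges G (x ∷ xs ++ y ∷ [])) _ ⟩
    pathEdges G (y ∷ ys ++ x ∷ []) ++ pathEdges G (x ∷ xs ++ y ∷ []) ≡⟨ pathEdges-++ (y ∷ ys) x (xs ++ y ∷ []) ⟨
    pathEdges G ((y ∷ ys) ++ x ∷ xs ++ y ∷ [])                      ≡⟨ cong (λ l → pathEdges G (y ∷ l)) (++-assoc ys (x ∷ xs) (y ∷ [])) ⟨
    pathEdges G (y ∷ (ys ++ x ∷ xs) ++ y ∷ [])                      ≡⟨ cycEdges-as-pathEdges y (ys ++ x ∷ xs) ⟨
    cycEdges G (y ∷ ys ++ x ∷ xs)                                    ∎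
    where open PermutationReasoning

  -- All that matters about a rotation of a cycle: same vertices, same edges.
  Rotated : List (Vertex G) → List (Vertex G) → Set
  Rotated D C = D ↭ C × cycEdges G D ↭ cycEdges G C

  rotated : ∀ xs ys → Rotated (ys ++ xs) (xs ++ ys)
  rotated xs ys = ++-comm ys xs , cycEdges-rotate ys xs

  Rotated-sym : ∀ {D C} → Rotated D C → Rotated C D
  Rotated-sym (D↭C , E↭) = ↭-sym D↭C , ↭-sym E↭

  IsBlossom-rotate : ∀ {M D C b} → Rotated D C → IsBlossom G M C b → IsBlossom G M D b
  IsBlossom-rotate {M} (D↭C , E↭) (((3≤ , unique , edges) , odd) , (k , len , count) , b∈ , uncovered) =
    ((subst (3 ≤_) (sym same-length) 3≤ , Permutationₛ.Unique-resp-↭ (setoid _) (↭⇒↭ₛ (↭-sym D↭C)) unique ,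
      All-resp-↭ (↭-sym E↭) edges) , subst Odd (sym same-length) odd) ,
    (k , trans same-length len , trans (countIn-↭ M E↭) count) ,
    ∈-resp-↭ (↭-sym D↭C) b∈ ,
    λ e e∈ → uncovered e (∈-resp-↭ E↭ e∈)
    where same-length = ↭-length D↭C

  Alternating-Agree : ∀ {M M′} L → Agree M M′ (pathEdges G L) → Alternating G M L → Alternating G M′ L
  Alternating-Agree []              _     _ = tt
  Alternating-Agree (_ ∷ [])        _     _ = tt
  Alternating-Agree (_ ∷ _ ∷ [])    _     _ = tt
  Alternating-Agree (a ∷ b ∷ c ∷ L) agree (ab|bc , alt) =
    transport ab|bc , Alternating-Agree (b ∷ c ∷ L) (agree ∘ there) alt
    where
    open Equivalence
    ab = agree (here refl)
    bc = agree (there (here refl))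
    transport : _ → _
    transport (inj₁ (ab∈ , bc∉)) = inj₁ (to ab ab∈ , bc∉ ∘ from bc)
    transport (inj₂ (ab∉ , bc∈)) = inj₂ (ab∉ ∘ from ab , to bc bc∈)

  Alternating-tail : ∀ {M} a L → Alternating G M (a ∷ L) → Alternating G M L
  Alternating-tail a []          _         = tt
  Alternating-tail a (_ ∷ [])    _         = tt
  Alternating-tail a (_ ∷ _ ∷ _) (_ , alt) = alt

  Alternating-++⁻ˡ : ∀ {M} xs {ys} → Alternating G M (xs ++ ys) → Alternating G M xs
  Alternating-++⁻ˡ []              _             = tt
  Alternating-++⁻ˡ (_ ∷ [])        _             = tt
  Alternating-++⁻ˡ (_ ∷ _ ∷ [])    _             = tt
  Alternating-++⁻ˡ (a ∷ b ∷ c ∷ L) (ab|bc , alt) = ab|bc , Alternating-++⁻ˡ (b ∷ c ∷ L) alt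

  Alternating-last : ∀ {M} a L {b c} → Alternating G M (a ∷ L ++ b ∷ c ∷ []) → ¬ InM G M (b , c) →
                     InM G M (lastOf a L , b)
  Alternating-last a []      (inj₁ (ab , _)  , _) bc∉ = ab
  Alternating-last a []      (inj₂ (_  , bc) , _) bc∉ = ⊥-elim (bc∉ bc)
  Alternating-last a (x ∷ L) alt                   bc∉ =
    Alternating-last x L (Alternating-tail a (x ∷ L ++ _) alt) bc∉

  Alternating-extend : ∀ {M} a L {y z} → Alternating G M (a ∷ L) →
                       (∀ {u} → u ∈ a ∷ L → ¬ InM G M (u , lastOf a L)) →
                       InM G M (lastOf a L , y) → ¬ InM G M (y , z) →
                       Alternating G M (a ∷ L ++ y ∷ z ∷ [])
  Alternating-extend a []          alt           end-free xy yz∉ = inj₁ (xy , yz∉) , tt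
  Alternating-extend a (b ∷ [])    alt           end-free xy yz∉ =
    inj₂ (end-free (here refl) , xy) , inj₁ (xy , yz∉) , tt
  Alternating-extend a (b ∷ c ∷ L) (ab|bc , alt) end-free xy yz∉ =
    ab|bc , Alternating-extend b (c ∷ L) alt (end-free ∘ there) xy yz∉

  -- Paths whose M-edges pair up consecutive vertices

  data Paired (M : List (Pair G)) : List (Vertex G) → Vertex G → Set where
    [_] : ∀ w → Paired M (w ∷ []) w
    _∷_ : ∀ {a b L w} → InM G M (a , b) → Paired M L w → Paired M (a ∷ b ∷ L) w

  Paired-partner : ∀ {M L w v u} → IsMatching G M → Paired M L w → v ∈ L → v ≢ w → InM G M (v , u) → u ∈ L
  Paired-partner M-matching [ w ]    (here refl)         v≢w vu = ⊥-elim (v≢w refl)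
  Paired-partner M-matching (ab ∷ P) (here refl)         v≢w vu =
    there (here (sym (partner-unique M-matching ab vu)))
  Paired-partner M-matching (ab ∷ P) (there (here refl)) v≢w vu =
    here (sym (partner-unique M-matching (InM-sym ab) vu))
  Paired-partner M-matching (ab ∷ P) (there (there v∈))  v≢w vu =
    there (there (Paired-partner M-matching P v∈ v≢w vu))

  stem-Paired : ∀ {M} a L → Alternating G M (a ∷ L) → Even (length L) → ¬ Saturated G M (lastOf a L) →
                Paired M (a ∷ L) (lastOf a L)
  stem-Paired a []          alt ev end-free = [ a ]
  stem-Paired a (b ∷ [])    alt ev end-free = ⊥-elim (¬Even-1 ev)
  stem-Paired a (b ∷ c ∷ L) (ab|bc , alt) ev end-free =
    first ab|bc (bc∉ P alt) ∷ P
    where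
    P = stem-Paired c L (Alternating-tail b (c ∷ L) alt) (Even-pred ev) end-free
    first : ∀ {A B : Set} → (A × ¬ B) ⊎ (¬ A × B) → ¬ B → A
    first (inj₁ (a , _)) ¬b = a
    first (inj₂ (_ , b)) ¬b = ⊥-elim (¬b b)
    bc∉ : Paired _ (c ∷ L) (lastOf c L) → Alternating G _ (b ∷ c ∷ L) → ¬ InM G _ (b , c)
    bc∉ [ c ]    _                          = end-free ∘ InM⇒Saturatedʳ
    bc∉ (cd ∷ _) (inj₁ (_ , cd∉) , _) _     = cd∉ cd
    bc∉ (cd ∷ _) (inj₂ (bc∉′ , _) , _)      = bc∉′

  module _ {M : List (Pair G)} (M-matching : IsMatching G M) where

    countIn-pathEdges-matched : ∀ {a b} L → InM G M (a , b) → a ∉ L →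
                                countIn M (pathEdges G (a ∷ b ∷ L)) ≡ suc (countIn M (pathEdges G L))
    countIn-pathEdges-matched []      ab a∉L = countIn-∷-∈ [] ab
    countIn-pathEdges-matched (c ∷ L) ab a∉L =
      trans (countIn-∷-∈ (pathEdges G (_ ∷ c ∷ L)) ab)
            (cong suc (countIn-∷-∉ (pathEdges G (c ∷ L)) (λ bc → a∉L (here (partner-unique M-matching (InM-sym ab) bc)))))

    countIn-pathEdges-≤ : ∀ L → Unique L →
                          countIn M (pathEdges G L) + countIn M (pathEdges G L) ≤ length L
    countIn-pathEdges-≤ []          _ = z≤n
    countIn-pathEdges-≤ (a ∷ [])    _ = z≤n
    -- Both recursive calls are made here: under a with, the termination checker
    -- would not see that b ∷ L is smaller than a ∷ b ∷ L.
    countIn-pathEdges-≤ (a ∷ b ∷ L) unique =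
      by-first-edge (inM? G M (a , b))
        (countIn-pathEdges-≤ L (AllPairs.tail (AllPairs.tail unique)))
        (countIn-pathEdges-≤ (b ∷ L) (AllPairs.tail unique))
      where
      count : List (Vertex G) → ℕ
      count L = countIn M (pathEdges G L)
      by-first-edge : Dec (InM G M (a , b)) → count L + count L ≤ length L → count (b ∷ L) + count (b ∷ L) ≤ suc (length L) →
                      count (a ∷ b ∷ L) + count (a ∷ b ∷ L) ≤ suc (suc (length L))
      by-first-edge (yes ab) bound-L _ rewrite countIn-pathEdges-matched L ab (Unique[x∷xs]⇒x∉xs unique ∘ there) =
        s≤s (subst (_≤ suc (length L)) (sym (+-suc (count L) (count L))) (s≤s bound-L))
      by-first-edge (no ab∉) _ bound-bL rewrite countIn-∷-∉ (pathEdges G (b ∷ L)) ab∉ = m≤n⇒m≤1+n bound-bL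

    perfect-Paired : ∀ L {w} → Unique L → countIn M (pathEdges G L) + countIn M (pathEdges G L) ≡ length L →
                     Paired M (L ++ w ∷ []) w
    perfect-Paired []          _ _ = [ _ ]
    perfect-Paired (a ∷ [])    _ ()
    perfect-Paired (a ∷ b ∷ L) unique perfect with inM? G M (a , b)
    ... | yes ab = ab ∷ perfect-Paired L (AllPairs.tail (AllPairs.tail unique)) (double-suc-injective _ _
                     (subst (λ m → m + m ≡ _) (countIn-pathEdges-matched L ab (Unique[x∷xs]⇒x∉xs unique ∘ there)) perfect))
    ... | no ab∉ = ⊥-elim (1+n≰n (subst (_≤ suc (length L))
                     (trans (cong (λ m → m + m) (sym (countIn-∷-∉ (pathEdges G (b ∷ L)) ab∉))) perfect)
                     (countIn-pathEdges-≤ (b ∷ L) (AllPairs.tail unique))))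

    blossom-Paired : ∀ {c t T} → IsBlossom G M (c ∷ t ∷ T) c → Paired M (t ∷ T ++ c ∷ []) c
    blossom-Paired {c} {t} {T} (((_ , unique , _) , _) , (k , len , count) , _ , uncovered) =
      perfect-Paired (t ∷ T) (AllPairs.tail unique)
        (trans (cong (λ m → m + m) path-count) (sym (suc-injective len)))
      where
      open ≡-Reasoning
      closing = (lastOf t T , c) ∷ []
      edges≡ : cycEdges G (c ∷ t ∷ T) ≡ (c , t) ∷ pathEdges G (t ∷ T) ++ closing
      edges≡ = trans (cycEdges-as-pathEdges c (t ∷ T)) (cong ((c , t) ∷_) (pathEdges-snoc t T c))
      ∉M : ∀ {e} → e ∈ (c , t) ∷ pathEdges G (t ∷ T) ++ closing → Covers G c e → ¬ InM G M e
      ∉M {e} e∈ c-covers e∈M = uncovered e (subst (e ∈_) (sym edges≡) e∈) e∈M c-covers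
      path-count : countIn M (pathEdges G (t ∷ T)) ≡ k
      path-count = begin
        countIn M (pathEdges G (t ∷ T))                             ≡⟨ +-identityʳ _ ⟨
        countIn M (pathEdges G (t ∷ T)) + 0                         ≡⟨ cong (countIn M (pathEdges G (t ∷ T)) +_)
                                                                          (countIn-∷-∉ [] (∉M (there (∈-++⁺ʳ _ (here refl))) (inj₂ refl))) ⟨
        countIn M (pathEdges G (t ∷ T)) + countIn M closing         ≡⟨ countIn-++ M (pathEdges G (t ∷ T)) closing ⟨
        countIn M (pathEdges G (t ∷ T) ++ closing)                  ≡⟨ countIn-∷-∉ _ (∉M (here refl) (inj₁ refl)) ⟨
        countIn M ((c , t) ∷ pathEdges G (t ∷ T) ++ closing)        ≡⟨ cong (countIn M) edges≡ ⟨
        countIn M (cycEdges G (c ∷ t ∷ T))                          ≡⟨ count ⟩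
        k                                                           ∎

  blossom-from-base : ∀ {M C c} → IsBlossom G M C c → ∃[ t ] ∃[ T ] Rotated (c ∷ t ∷ T) C
  blossom-from-base {C = C} (((3≤ , _) , _) , _ , c∈C , _) with ∈-∃++ c∈C
  ... | ys , zs , refl with zs ++ ys | rotated ys (_ ∷ zs)
  ... | []    | (D↭C , _) with subst (3 ≤_) (sym (↭-length D↭C)) 3≤
  ...   | s≤s ()
  blossom-from-base _ | ys , zs , refl | t ∷ T | rotation = t , T , rotation

  blossom-partner : ∀ {M C c v u} → IsMatching G M → IsBlossom G M C c →
                    v ∈ C → v ≢ c → InM G M (v , u) → u ∈ C
  blossom-partner {c = c} {v} M-matching blossom v∈C v≢c vu with blossom-from-base blossom
  ... | t , T , rotation@(D↭C , _) =
    ∈-resp-↭ D↭C (closing (Paired-partner M-matching (blossom-Paired M-matching (IsBlossom-rotate rotation blossom))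
                                          (opening (∈-resp-↭ (↭-sym D↭C) v∈C)) v≢c vu))
    where
    opening : v ∈ c ∷ t ∷ T → v ∈ t ∷ T ++ c ∷ []
    opening (here refl) = ⊥-elim (v≢c refl)
    opening (there v∈)  = ∈-++⁺ˡ v∈
    closing : ∀ {x} → x ∈ t ∷ T ++ c ∷ [] → x ∈ c ∷ t ∷ T
    closing x∈ with ∈-++⁻ (t ∷ T) x∈
    ... | inj₁ x∈tT         = there x∈tT
    ... | inj₂ (here refl)  = here refl

  -- Flowers and stems

  stem-end-free : ∀ {M C c p Ps} → IsStem G M C c (p ∷ Ps) → ¬ Saturated G M (lastOf p Ps)
  stem-end-free {M} {p = p} {Ps} (_ , _ , _ , _ , _ , (w , last≡w , w-free) , _)
    with refl ← trans (sym last≡w) (last≡lastOf p Ps) = w-free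

  stem-partner : ∀ {M C c p Ps v u} → IsMatching G M → IsStem G M C c (p ∷ Ps) →
                 v ∈ p ∷ Ps → InM G M (v , u) → u ∈ p ∷ Ps
  stem-partner {p = p} {Ps} {v} M-matching stem@(_ , _ , _ , alt , even , _) v∈ vu with v ≟ᶠ lastOf p Ps
  ... | yes refl = ⊥-elim (stem-end-free stem (InM⇒Saturatedˡ vu))
  ... | no  v≢w  = Paired-partner M-matching (stem-Paired p Ps alt even (stem-end-free stem)) v∈ v≢w vu

  flower-closed : ∀ {M C c P v u} → IsMatching G M → IsFlower G M C c P →
                  InFlower G C P v → InM G M (v , u) → InFlower G C P u
  flower-closed {c = c} {p ∷ Ps} {v} M-matching (blossom , stem@(p≡c , _)) v∈F vu with v∈F | v ≟ᶠ c
  ... | inj₂ v∈P | _        = inj₂ (stem-partner M-matching stem v∈P vu)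
  ... | inj₁ v∈C | yes refl = inj₂ (stem-partner M-matching stem (here (sym p≡c)) vu)
  ... | inj₁ v∈C | no  v≢c  = inj₁ (blossom-partner M-matching blossom v∈C v≢c vu)

  stem-extend : ∀ {M C c p Ps y z} → IsMatching G M → IsStem G M C c (p ∷ Ps) →
                E (lastOf p Ps) y → InM G M (y , z) → y ∉ C → y ∉ p ∷ Ps → z ∉ C → z ∉ p ∷ Ps →
                IsStem G (exchange M (lastOf p Ps) y z) C c (p ∷ Ps ++ y ∷ z ∷ [])
  stem-extend {M} {C} {c} {p} {Ps} {y} {z} M-matching stem@(p≡c , unique , edges , alt , even , _ , outside)
              xy yz y∉C y∉P z∉C z∉P =
    p≡c ,
    Unique.++⁺ unique ((y≢z ∷ []) ∷ [] ∷ []) (λ { (v∈P , here refl) → y∉P v∈P ; (v∈P , there (here refl)) → z∉P v∈P }) ,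
    subst (All _) (sym (pathEdges-extend p Ps y z)) (All.++⁺ edges (xy ∷ InM⇒E M-matching yz ∷ [])) ,
    Alternating-extend p Ps (Alternating-Agree (p ∷ Ps) (exchange-Agree {M} {x} {y} {z} y∉P (pathEdges-within _)) alt)
                       x-unmatched (exchange-InM-new {M} {x} {y} {z}) (z-free ∘ InM⇒Saturatedʳ) ,
    subst Even (sym (length-++-pair Ps {y} {z})) (Even-suc-suc even) ,
    (z , trans (last≡lastOf p (Ps ++ y ∷ z ∷ [])) (cong just (lastOf-++ p Ps)) , z-free) ,
    λ { v v∈ → [ outside v , (λ { (here refl) → y∉C ; (there (here refl)) → z∉C }) ]′ (∈-++⁻ Ps v∈) }
    where
    x = lastOf p Ps
    x-free = stem-end-free stem
    z-free = exchange-unsaturated M-matching x-free yz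
    y≢z : y ≢ z
    y≢z refl = E-irrefl (InM⇒E M-matching yz)
    x-unmatched : ∀ {u} → u ∈ p ∷ Ps → ¬ InM G (exchange M x y z) (u , x)
    x-unmatched u∈ ux with exchange-InM⁻ {M} {x} {y} {z} ux
    ... | inj₁ refl        = y∉P u∈
    ... | inj₂ (inj₁ refl) = y∉P (lastOf-∈ p Ps)
    ... | inj₂ (inj₂ ux∈M) = x-free (InM⇒Saturatedʳ ux∈M)

  stem-end-neighbour-in-R : ∀ {M C c p Ps y} → IsMaximumMatching G M → IsFlower G M C c (p ∷ Ps) →
                            E (lastOf p Ps) y → R G C y
  stem-end-neighbour-in-R {M} {C} {c} {p} {Ps} {y} M-max@(M-matching , _) flower@(blossom , stem) xy
    with y ∈? C | y ∈? p ∷ Ps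
  ... | yes y∈C | _       = M , M-max , c , p ∷ Ps , flower , inj₁ y∈C
  ... | no _    | yes y∈P = M , M-max , c , p ∷ Ps , flower , inj₂ y∈P
  ... | no y∉C  | no y∉P with saturated? M y
  ...   | no y-free = ⊥-elim (maximum⇒¬free-edge M-max x-free y-free xy)
    where x-free = stem-end-free stem
  ...   | yes y-sat with Saturated⇒InM y-sat
  ...     | z , yz =
    exchange M x y z , exchange-isMaximum M-max x-free xy yz , c , p ∷ Ps ++ y ∷ z ∷ [] ,
    (IsBlossom-Agree (exchange-Agree {M} {x} {y} {z} y∉C (cycEdges-within C)) blossom ,
     stem-extend M-matching stem xy yz y∉C y∉P (z∉F ∘ inj₁) (z∉F ∘ inj₂)) ,
    inj₂ (∈-++⁺ʳ (p ∷ Ps) (here refl))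
    where
    x = lastOf p Ps
    x-free = stem-end-free stem
    z∉F : ¬ InFlower G C (p ∷ Ps) z
    z∉F z∈F = [ y∉C , y∉P ]′ (flower-closed M-matching flower z∈F (InM-sym yz))

  stem-shorten : ∀ {M C c p Ps a w} → IsMaximumMatching G M → IsFlower G M C c (p ∷ Ps ++ a ∷ w ∷ []) →
                 ∃[ M′ ] IsMaximumMatching G M′ × IsFlower G M′ C c (p ∷ Ps)
  stem-shorten {M} {C} {c} {p} {Ps} {a} {w} M-max@(M-matching , _)
               (blossom , stem@(p≡c , unique , edges , alt , even , _ , outside)) =
    exchange M w a q ,
    exchange-isMaximum M-max w-free (E-sym aw) (InM-sym qa) ,
    IsBlossom-Agree (exchange-Agree {M} {w} {a} {q} (outside a (∈-++⁺ʳ Ps (here refl))) (cycEdges-within C)) blossom ,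
    p≡c ,
    AllPairs-++⁻ˡ (p ∷ Ps) unique ,
    All.++⁻ˡ _ path-edges ,
    Alternating-Agree (p ∷ Ps) (exchange-Agree {M} {w} {a} {q} a∉P (pathEdges-within _)) (Alternating-++⁻ˡ (p ∷ Ps) alt) ,
    Even-pred (subst Even (length-++-pair Ps) even) ,
    (q , last≡lastOf p Ps , exchange-unsaturated M-matching w-free (InM-sym qa)) ,
    λ v v∈ → outside v (∈-++⁺ˡ v∈)
    where
    q = lastOf p Ps
    w-free : ¬ Saturated G M w
    w-free = subst (¬_ ∘ Saturated G M) (lastOf-++ p Ps) (stem-end-free stem)
    qa : InM G M (q , a)
    qa = Alternating-last p Ps alt (w-free ∘ InM⇒Saturatedʳ)
    path-edges = subst (All _) (pathEdges-extend p Ps a w) edges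
    aw : E a w
    aw = All.lookup (All.++⁻ʳ (pathEdges G (p ∷ Ps)) path-edges) (there (here refl))
    a∉P : a ∉ p ∷ Ps
    a∉P a∈P = AllPairs-++⁻-across (p ∷ Ps) unique a∈P (here refl) refl

  stem-shorten-even : ∀ {C c p} Ps B → Even (length B) → ∀ {M} → IsMaximumMatching G M →
                      IsFlower G M C c (p ∷ Ps ++ B) → ∃[ M′ ] IsMaximumMatching G M′ × IsFlower G M′ C c (p ∷ Ps)
  stem-shorten-even {C} {c} {p} Ps [] _ {M} M-max flower =
    M , M-max , subst (λ L → IsFlower G M C c (p ∷ L)) (++-identityʳ Ps) flower
  stem-shorten-even Ps (_ ∷ []) even = ⊥-elim (¬Even-1 even)
  stem-shorten-even {C} {c} {p} Ps (a ∷ w ∷ B) even {M} M-max flower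
    with stem-shorten-even (Ps ++ a ∷ w ∷ []) B (Even-pred even) M-max
           (subst (λ L → IsFlower G M C c (p ∷ L)) (sym (++-assoc Ps (a ∷ w ∷ []) B)) flower)
  ... | M′ , M′-max , flower′ = stem-shorten M′-max flower′

  pathEdges-[]= : ∀ {L u v} → (u , v) ∈ pathEdges G L → ∃[ j ] L [ j ]= u × L [ suc j ]= v
  pathEdges-[]= {a ∷ b ∷ L} (here refl) = 0 , here , there here
  pathEdges-[]= {a ∷ b ∷ L} (there e∈) with pathEdges-[]= {b ∷ L} e∈
  ... | j , u-at , v-at = suc j , there u-at , there v-at

  []=-pathEdges : ∀ {L j v} → L [ suc j ]= v → ∃[ u ] L [ j ]= u × (u , v) ∈ pathEdges G L
  []=-pathEdges {a ∷ b ∷ L} {zero}  (there here)  = a , here , here refl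
  []=-pathEdges {a ∷ b ∷ L} {suc j} (there v-at) with []=-pathEdges v-at
  ... | u , u-at , e∈ = u , there u-at , there e∈

  module _ {C : List (Vertex G)} {p Ps} (unique : Unique (p ∷ Ps)) (outside : ∀ v → v ∈ Ps → v ∉ C) where

    -- A walk can leave the stem only at its head, the one stem vertex on C.
    stem-walk-≥ : ∀ {u i k} → FWalk G C (p ∷ Ps) u p k → p ∷ Ps [ i ]= u → i ≤ k
    stem-walk-≥ here                 u-at with []=-injective unique u-at here
    ... | refl = z≤n
    stem-walk-≥ (step (inj₁ e∈C) walk) here = z≤n
    stem-walk-≥ (step (inj₁ e∈C) walk) (there u-at) = ⊥-elim (outside _ ([]=⇒∈ u-at) (u∈C e∈C))
      where
      u∈C : ∀ {u v} → InM G (cycEdges G C) (u , v) → u ∈ C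
      u∈C (inj₁ uv∈) = proj₁ (cycEdges-within C uv∈)
      u∈C (inj₂ vu∈) = proj₂ (cycEdges-within C vu∈)
    stem-walk-≥ (step (inj₂ (inj₁ uv∈)) walk) u-at with pathEdges-[]= uv∈
    ... | j , u-at′ , v-at with refl ← []=-injective unique u-at u-at′ =
      m≤n⇒m≤1+n (<⇒≤ (stem-walk-≥ walk v-at))
    stem-walk-≥ (step (inj₂ (inj₂ vu∈)) walk) u-at with pathEdges-[]= vu∈
    ... | j , v-at , u-at′ with refl ← []=-injective unique u-at u-at′ =
      s≤s (stem-walk-≥ walk v-at)

    stem-walk-to-head : ∀ {i v} → p ∷ Ps [ i ]= v → FWalk G C (p ∷ Ps) v p i
    stem-walk-to-head here = here
    stem-walk-to-head {suc i} v-at with []=-pathEdges v-at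
    ... | u , u-at , uv∈ = step (inj₂ (inj₂ uv∈)) (stem-walk-to-head u-at)

    stem-distance : ∀ {i x d} → p ∷ Ps [ i ]= x → FDist G C (p ∷ Ps) x p d → i ≡ d
    stem-distance x-at (walk , shortest) = ≤-antisym (stem-walk-≥ walk x-at) (shortest _ (stem-walk-to-head x-at))

  even-stem-vertex-neighbour-in-R : ∀ {M C c P x d y} → IsMaximumMatching G M → IsFlower G M C c P → x ∈ P →
                                    FDist G C P x c d → Even d → E x y → R G C y
  even-stem-vertex-neighbour-in-R {M} {C} {c} {p ∷ Ps} M-max flower@(_ , p≡c , unique , _ , _ , even , _ , outside)
                                   x∈P dist (h , refl) xy
    with ∈⇒[]= x∈P
  ... | i , x-at with []=-split x-at | stem-distance unique outside x-at (subst (λ b → FDist G C (p ∷ Ps) _ b _) (sym p≡c) dist)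
  ... | As , B , refl , refl , refl | |As|≡h+h
    with stem-shorten-even As B (Even-double+⁻ h (subst (λ m → Even (m + length B)) |As|≡h+h (subst Even (length-++ As) even)))
                           M-max flower
  ... | M′ , M′-max , flower′ = stem-end-neighbour-in-R M′-max flower′ xy

  -- Moving a free base around the blossom

  FreeBlossom : List (Pair G) → List (Vertex G) → Vertex G → Set
  FreeBlossom M C b = IsMaximumMatching G M × IsBlossom G M C b × ¬ Saturated G M b

  FreeBlossom-rotate : ∀ {M D C b} → Rotated D C → FreeBlossom M C b → FreeBlossom M D b
  FreeBlossom-rotate rotation (M-max , blossom , b-free) = M-max , IsBlossom-rotate rotation blossom , b-free

  FreeBlossom⇒IsFlower : ∀ {M C b} → FreeBlossom M C b → IsFlower G M C b (b ∷ [])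
  FreeBlossom⇒IsFlower {b = b} (_ , blossom , b-free) =
    blossom , refl , ([] ∷ []) , [] , tt , (0 , refl) , (b , refl , b-free) , λ _ ()

  advance : ∀ {M b d₁ d₂ T} → FreeBlossom M (b ∷ d₁ ∷ d₂ ∷ T) b →
            FreeBlossom (exchange M b d₁ d₂) (b ∷ d₁ ∷ d₂ ∷ T) d₂
  advance {M} {b} {d₁} {d₂} {T}
          (M-max@(M-matching , _) , blossom@(odd-cycle@((_ , unique , edges) , _) , (k , len , count) , _) , b-free)
    with blossom-Paired M-matching blossom
  ... | d₁d₂ ∷ _ =
    exchange-isMaximum M-max b-free (All.lookup edges (here refl)) d₁d₂ ,
    (odd-cycle , (k , len , count′) , there (there (here refl)) , d₂-uncovered) ,
    d₂-free
    where
    open ≡-Reasoning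
    M′ = exchange M b d₁ d₂
    d₂-free = exchange-unsaturated M-matching b-free d₁d₂
    d₂-uncovered : ∀ e → e ∈ cycEdges G (b ∷ d₁ ∷ d₂ ∷ T) → InM G M′ e → ¬ Covers G d₂ e
    d₂-uncovered _ _ e∈M′ (inj₁ refl) = d₂-free (InM⇒Saturatedˡ e∈M′)
    d₂-uncovered _ _ e∈M′ (inj₂ refl) = d₂-free (InM⇒Saturatedʳ e∈M′)
    rest = pathEdges G (d₂ ∷ T ++ b ∷ [])
    d₁∉rest : d₁ ∉ d₂ ∷ T ++ b ∷ []
    d₁∉rest d₁∈ with ∈-++⁻ (d₂ ∷ T) d₁∈
    ... | inj₁ d₁∈d₂T       = Unique[x∷xs]⇒x∉xs (AllPairs.tail unique) d₁∈d₂T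
    ... | inj₂ (here refl)  = Unique[x∷xs]⇒x∉xs unique (here refl)
    count′ : countIn M′ (cycEdges G (b ∷ d₁ ∷ d₂ ∷ T)) ≡ k
    count′ = begin
      countIn M′ (cycEdges G (b ∷ d₁ ∷ d₂ ∷ T)) ≡⟨ cong (countIn M′) (cycEdges-as-pathEdges b (d₁ ∷ d₂ ∷ T)) ⟩
      countIn M′ ((b , d₁) ∷ (d₁ , d₂) ∷ rest)  ≡⟨ countIn-∷-∈ {e = b , d₁} _ (exchange-InM-new {M} {b} {d₁} {d₂}) ⟩
      suc (countIn M′ ((d₁ , d₂) ∷ rest))      ≡⟨ cong suc (countIn-∷-∉ {e = d₁ , d₂} rest (d₂-free ∘ InM⇒Saturatedʳ)) ⟩
      suc (countIn M′ rest)                     ≡⟨ cong suc (countIn-Agree rest (exchange-Agree {M} {b} {d₁} {d₂} d₁∉rest (pathEdges-within _))) ⟨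
      suc (countIn M rest)                      ≡⟨ countIn-∷-∈ rest d₁d₂ ⟨
      countIn M ((d₁ , d₂) ∷ rest)              ≡⟨ countIn-∷-∉ {e = b , d₁} _ (b-free ∘ InM⇒Saturatedˡ) ⟨
      countIn M ((b , d₁) ∷ (d₁ , d₂) ∷ rest)   ≡⟨ cong (countIn M) (cycEdges-as-pathEdges b (d₁ ∷ d₂ ∷ T)) ⟨
      countIn M (cycEdges G (b ∷ d₁ ∷ d₂ ∷ T))  ≡⟨ count ⟩
      k                                         ∎

  advance-rotated : ∀ {M b d₁ d₂ T} → FreeBlossom M (b ∷ d₁ ∷ d₂ ∷ T) b →
                    FreeBlossom (exchange M b d₁ d₂) (d₂ ∷ T ++ b ∷ d₁ ∷ []) d₂
  advance-rotated {b = b} {d₁} {d₂} {T} free = FreeBlossom-rotate (rotated (b ∷ d₁ ∷ []) (d₂ ∷ T)) (advance free)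

  move-base-even : ∀ {M b L i x} → FreeBlossom M (b ∷ L) b → b ∷ L [ i ]= x → Even i →
                   ∃[ M′ ] FreeBlossom M′ (b ∷ L) x
  move-base-even free here                 even = _ , free
  move-base-even free (there here)         even = ⊥-elim (¬Even-1 even)
  move-base-even {b = b} {d₁ ∷ d₂ ∷ T} {suc (suc i)} free (there (there x-at)) even
    with move-base-even (advance-rotated free) ([]=-++ˡ x-at) (Even-pred even)
  ... | M′ , free′ = M′ , FreeBlossom-rotate (rotated (d₂ ∷ T) (b ∷ d₁ ∷ [])) free′

  move-base-odd : ∀ {M b L i x} → FreeBlossom M (b ∷ L) b → b ∷ L [ i ]= x → Odd i →
                  ∃[ M′ ] FreeBlossom M′ (b ∷ L) x
  move-base-odd free here (_ , ())
  move-base-odd {L = _ ∷ []} (_ , (((s≤s (s≤s ()) , _) , _) , _) , _) (there here) _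
  -- x = d₁ moves to the last position |C| − 1, which is even as C is odd.
  move-base-odd {b = b} {x ∷ d₂ ∷ T} free@(_ , (_ , (k , len , _) , _) , _) (there here) _
    with move-base-even (advance-rotated free) (subst (_[ length (d₂ ∷ T ++ b ∷ []) ]= x) (++-assoc (d₂ ∷ T) (b ∷ []) (x ∷ []))
                                                      ([]=-++ (d₂ ∷ T ++ b ∷ [])))
                        (k , trans (cong suc (trans (length-++ T) (+-comm (length T) 1))) (suc-injective len))
  ... | M′ , free′ = M′ , FreeBlossom-rotate (rotated (d₂ ∷ T) (b ∷ x ∷ [])) free′
  move-base-odd {b = b} {d₁ ∷ d₂ ∷ T} {suc (suc i)} free (there (there x-at)) odd
    with move-base-odd (advance-rotated free) ([]=-++ˡ x-at) (Odd-pred odd)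
  ... | M′ , free′ = M′ , FreeBlossom-rotate (rotated (d₂ ∷ T) (b ∷ d₁ ∷ [])) free′

  move-base : ∀ {M b L i x} → FreeBlossom M (b ∷ L) b → b ∷ L [ i ]= x → ∃[ M′ ] FreeBlossom M′ (b ∷ L) x
  move-base {i = i} free x-at = [ move-base-even free x-at , move-base-odd free x-at ]′ (parity i)

  cycle-vertex-neighbour-in-R : ∀ {M C c P x y} → IsMaximumMatching G M → IsFlower G M C c P → x ∈ C →
                                E x y → R G C y
  cycle-vertex-neighbour-in-R {C = C} {P = p ∷ Ps} M-max flower@(_ , _ , _ , _ , _ , even , _) x∈C xy
    with stem-shorten-even [] Ps even M-max flower
  ... | M₁ , M₁-max , blossom₁ , stem₁@(refl , _) with blossom-from-base blossom₁
  ... | t , T , rotation@(D↭C , _) with ∈⇒[]= (∈-resp-↭ (↭-sym D↭C) x∈C)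
  ... | _ , x-at with move-base (FreeBlossom-rotate rotation (M₁-max , blossom₁ , stem-end-free stem₁)) x-at
  ... | M₂ , free₂ with FreeBlossom-rotate (Rotated-sym rotation) free₂
  ... | free₂′@(M₂-max , _) = stem-end-neighbour-in-R M₂-max (FreeBlossom⇒IsFlower free₂′) xy

mainTheorem11 : (n : ℕ) (G : Graph n) → RDisjoint G →
    ∀ C → IsOddCycle G C →
    ∀ x → (x ∈ C ⊎ REven G C x) →
    ∀ y → Graph.E G x y → R G C y
mainTheorem11 n G (_ , R-nonempty , _) C odd-cycle x (inj₁ x∈C) y xy
  with R-nonempty C odd-cycle
... | _ , M , M-max , c , P , flower , _ = cycle-vertex-neighbour-in-R G M-max flower x∈C xy
mainTheorem11 n G _ C _ x (inj₂ (_ , x∉C , _ , _ , _ , _ , _ , inj₁ x∈C , _)) y xy = ⊥-elim (x∉C x∈C)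
mainTheorem11 n G _ C _ x (inj₂ (_ , _ , M , M-max , c , P , flower , inj₂ x∈P , d , dist , even)) y xy =
  even-stem-vertex-neighbour-in-R G M-max flower x∈P dist even xy
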